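{- For every integer $m\ge 2$, the graph $P_m$ is well-covered.
   Context: For $m\ge2$, $P_m$ is the graph with vertex set $X\cup Y\cup Z$, $X=\{x_1,\ldots,x_{2m}\}$, $Y=\{y_1,y_2\}$, $Z=\{z_1,z_2,z_3\}$, whose edges are exactly: (i) the induced subgraph on $X$ is the complete $m$-partite graph $K_{2,\ldots,2}$ whose complement is the matching $\{x_{2i-1},x_{2i}\}$, $1\le i\le m$ (so $x_a,x_b$ are adjacent iff $\{a,b\}\ne\{2i-1,2i\}$ for all $i$); (ii) $y_1$ is adjacent to $z_1$ and to each $x_{2i-1}$, $1\le i\le m$; (iii) $y_2$ is adjacent to $z_2$ and to each $x_{2i}$, $1\le i\le m$; (iv) $Z$ induces a triangle $K_3$. A graph is well-covered if all its maximal independent sets have the same cardinality. -}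

module Defs where

open import Data.Nat using (ℕ; _*_; _+_)
open import Data.Fin using (Fin; zero; suc; splitAt; quotRem)
open import Data.Fin.Subset using (Subset; _∈_; _∉_; ∣_∣; ⁅_⁆; _∪_)
open import Data.Product using (_×_; _,_)
open import Data.Sum using (_⊎_; inj₁; inj₂)
open import Data.Empty using (⊥)
open import Data.Unit using (⊤)
open import Relation.Binary.PropositionalEquality using (_≡_; _≢_)
open import Relation.Nullary using (¬_)

Graph : ℕ → Set₁
Graph n = Fin n → Fin n → Set

Independent : ∀ {n} → Graph n → Subset n → Set
Independent G S = ∀ u v → u ∈ S → v ∈ S → ¬ G u v

MaximalIndependent : ∀ {n} → Graph n → Subset n → Set
MaximalIndependent G S =
  Independent G S × (∀ v → v ∉ S → ¬ Independent G (⁅ v ⁆ ∪ S))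

WellCovered : ∀ {n} → Graph n → Set
WellCovered G = ∀ S T → MaximalIndependent G S → MaximalIndependent G T → ∣ S ∣ ≡ ∣ T ∣

-- Vertices, as a labelled type:
--   xv i s  (i : Fin m, s : Fin 2)  is  x_{2(i+1)-1} if s = 0, x_{2(i+1)} if s = 1
--   yv k    (k : Fin 2)             is  y_{k+1}
--   zv l    (l : Fin 3)             is  z_{l+1}

data PVertex (m : ℕ) : Set where
  xv : Fin m → Fin 2 → PVertex m
  yv : Fin 2 → PVertex m
  zv : Fin 3 → PVertex m

PAdj : ∀ {m} → PVertex m → PVertex m → Set
-- (i) X induces K_{2,...,2}: x's adjacent iff not in the same pair
PAdj (xv i s) (xv j t) = i ≢ j
-- (ii),(iii) y_1 ~ x_{odd}, y_2 ~ x_{even}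
PAdj (xv i s) (yv k)   = s ≡ k
PAdj (yv k)   (xv i s) = s ≡ k
PAdj (xv _ _) (zv _)   = ⊥
PAdj (zv _)   (xv _ _) = ⊥
PAdj (yv _)   (yv _)   = ⊥
PAdj (yv zero)       (zv zero)       = ⊤
PAdj (yv (suc zero)) (zv (suc zero)) = ⊤
PAdj (yv _)          (zv _)          = ⊥
PAdj (zv zero)       (yv zero)       = ⊤
PAdj (zv (suc zero)) (yv (suc zero)) = ⊤
PAdj (zv _)          (yv _)          = ⊥
PAdj (zv l)   (zv l')  = l ≢ l'

-- Numbering of the 2m+5 vertices by Fin (m * 2 + 5):
-- index a < 2m  ↦ x_{a+1}  (pair a / 2, side a % 2);
-- then y_1, y_2, z_1, z_2, z_3.
decode : ∀ m → Fin (m * 2 + 5) → PVertex m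
decode m a with splitAt (m * 2) a
... | inj₁ b with quotRem {m} 2 b
...   | (s , i) = xv i s
decode m a | inj₂ c with splitAt 2 {3} c
...   | inj₁ k = yv k
...   | inj₂ l = zv l

P : (m : ℕ) → Graph (m * 2 + 5)
P m u v = PAdj (decode m u) (decode m v)

module Submission where

-- Every maximal independent set of P_m has exactly three vertices.
--
-- The vertices of P_m are covered by three cliques: the odd side
-- C₀ = {y₁} ∪ {x_{2i-1}}, the even side C₁ = {y₂} ∪ {x_{2i}}, and the
-- triangle Z.  An independent set meets each clique at most once, and a
-- maximal one meets each of them, because every vertex outside it has a
-- neighbour inside it.  If S missed the side C_s, the vertex x_{i,s} would
-- have a neighbour x_{j,t} ∈ S (j ≠ i); but then x_{j,s} ∉ S would have no
-- neighbour in S, since its neighbours are y_s ∈ C_s and the vertices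
-- x_{k,·} with k ≠ j, all adjacent to x_{j,t}.  If S missed Z, the vertex z₃
-- (whose neighbours all lie in Z) would have no neighbour in S.

open import Defs
open import Data.Nat using (ℕ; zero; suc; _≤_; _*_; _+_)
open import Data.Fin using (Fin; zero; suc; splitAt; quotRem; combine; _↑ˡ_; _↑ʳ_)
open import Data.Fin.Properties using (splitAt-↑ˡ; splitAt-↑ʳ; splitAt⁻¹-↑ˡ; splitAt⁻¹-↑ʳ; remQuot-combine; combine-remQuot; any?) renaming (_≟_ to _≟ᶠ_)
open import Data.Fin.Subset using (Subset; _∈_; _∉_; ∣_∣; ⁅_⁆; _∪_; ⋃; _⊆_; inside; outside)
open import Data.Fin.Subset.Properties using (x∈p∪q⁻; x∈p∪q⁺; x∈⁅y⁆⇒x≡y; x∈⁅x⁆; ∉⊥; ⊆-antisym; _∈?_; ∣⊥∣≡0; ∪-identityˡ)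
open import Data.List using (List; []; _∷_; map; tabulate; length)
open import Data.List.Properties using (length-tabulate)
open import Data.List.Membership.Propositional using () renaming (_∈_ to _∈ₗ_)
open import Data.List.Membership.Propositional.Properties using (∈-tabulate⁺; ∈-tabulate⁻)
open import Data.List.Relation.Unary.Any using (here; there)
open import Data.List.Relation.Unary.AllPairs using (_∷_)
open import Data.List.Relation.Unary.Unique.Propositional using (Unique)
open import Data.List.Relation.Unary.Unique.Propositional.Properties using (tabulate⁺; Unique[x∷xs]⇒x∉xs)
open import Data.Vec using (_∷_)
import Data.Vec.Base as Vec
open import Data.Product using (_×_; _,_; ∃; proj₁; proj₂; swap)
open import Data.Sum using (_⊎_; inj₁; inj₂)
open import Data.Empty using (⊥-elim)
open import Data.Unit using (tt)
open import Function using (_∘_)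
open import Relation.Binary.PropositionalEquality
open import Relation.Nullary using (¬_; yes; no)
open import Relation.Nullary.Decidable using (decidable-stable; _×-dec_)

∣⁅x⁆∪p∣≡1+∣p∣ : ∀ {n} (x : Fin n) (p : Subset n) → x ∉ p → ∣ ⁅ x ⁆ ∪ p ∣ ≡ suc ∣ p ∣
∣⁅x⁆∪p∣≡1+∣p∣ zero    (outside ∷ p) _   = cong (suc ∘ ∣_∣) (∪-identityˡ p)
∣⁅x⁆∪p∣≡1+∣p∣ zero    (inside  ∷ p) x∉p = ⊥-elim (x∉p Vec.here)
∣⁅x⁆∪p∣≡1+∣p∣ (suc x) (outside ∷ p) x∉p = ∣⁅x⁆∪p∣≡1+∣p∣ x p (x∉p ∘ Vec.there)
∣⁅x⁆∪p∣≡1+∣p∣ (suc x) (inside  ∷ p) x∉p = cong suc (∣⁅x⁆∪p∣≡1+∣p∣ x p (x∉p ∘ Vec.there))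

listed : ∀ {n} → List (Fin n) → Subset n
listed xs = ⋃ (map ⁅_⁆ xs)

∈-listed⁺ : ∀ {n} {x : Fin n} {xs} → x ∈ₗ xs → x ∈ listed xs
∈-listed⁺ (here refl)  = x∈p∪q⁺ (inj₁ (x∈⁅x⁆ _))
∈-listed⁺ (there x∈xs) = x∈p∪q⁺ (inj₂ (∈-listed⁺ x∈xs))

∈-listed⁻ : ∀ {n} {x : Fin n} xs → x ∈ listed xs → x ∈ₗ xs
∈-listed⁻ []       x∈ = ⊥-elim (∉⊥ x∈)
∈-listed⁻ (y ∷ ys) x∈ with x∈p∪q⁻ ⁅ y ⁆ (listed ys) x∈
... | inj₁ x∈⁅y⁆ = here (x∈⁅y⁆⇒x≡y y x∈⁅y⁆)
... | inj₂ x∈ys  = there (∈-listed⁻ ys x∈ys)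

∣listed∣ : ∀ {n} {xs : List (Fin n)} → Unique xs → ∣ listed xs ∣ ≡ length xs
∣listed∣ {n} {[]}     _            = ∣⊥∣≡0 n
∣listed∣ {n} {x ∷ xs} u@(_ ∷ uxs) = begin
  ∣ ⁅ x ⁆ ∪ listed xs ∣ ≡⟨ ∣⁅x⁆∪p∣≡1+∣p∣ x (listed xs) (Unique[x∷xs]⇒x∉xs u ∘ ∈-listed⁻ xs) ⟩
  suc ∣ listed xs ∣     ≡⟨ cong suc (∣listed∣ uxs) ⟩
  suc (length xs)       ∎
  where open ≡-Reasoning

∣transversal∣ : ∀ {n k} (S : Subset n) (label : Fin n → Fin k) →
                (∀ {u v} → u ∈ S → v ∈ S → label u ≡ label v → u ≡ v) →
                (∀ c → ∃ λ a → a ∈ S × label a ≡ c) → ∣ S ∣ ≡ k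
∣transversal∣ {n} {k} S label injective representative = begin
  ∣ S ∣                      ≡⟨ cong ∣_∣ (⊆-antisym S⊆reps reps⊆S) ⟩
  ∣ listed (tabulate rep) ∣  ≡⟨ ∣listed∣ (tabulate⁺ rep-injective) ⟩
  length (tabulate rep)      ≡⟨ length-tabulate rep ⟩
  k                          ∎
  where
  open ≡-Reasoning
  rep : Fin k → Fin n
  rep c = proj₁ (representative c)

  rep∈S : ∀ c → rep c ∈ S
  rep∈S c = proj₁ (proj₂ (representative c))

  label-rep : ∀ c → label (rep c) ≡ c
  label-rep c = proj₂ (proj₂ (representative c))

  rep-injective : ∀ {c d} → rep c ≡ rep d → c ≡ d
  rep-injective {c} {d} e = trans (sym (label-rep c)) (trans (cong label e) (label-rep d))

  -- each element of S is the representative of its own label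
  S⊆reps : S ⊆ listed (tabulate rep)
  S⊆reps {u} u∈S = ∈-listed⁺ (subst (_∈ₗ tabulate rep)
    (injective (rep∈S (label u)) u∈S (label-rep (label u))) (∈-tabulate⁺ (label u)))

  reps⊆S : listed (tabulate rep) ⊆ S
  reps⊆S u∈ with ∈-tabulate⁻ (∈-listed⁻ (tabulate rep) u∈)
  ... | c , refl = rep∈S c

outside-dominated : ∀ {n} (G : Graph n) → (∀ u → ¬ G u u) → (∀ u v → G u v → G v u) →
                    ∀ {S} → MaximalIndependent G S →
                    ∀ {v} → v ∉ S → ¬ (∀ u → u ∈ S → ¬ G v u)
outside-dominated G loopless symmetric {S} (independent , maximal) {v} v∉S isolated =
  maximal v v∉S independent-with-v
  where
  member : ∀ {x} → x ∈ ⁅ v ⁆ ∪ S → x ≡ v ⊎ x ∈ S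
  member x∈ with x∈p∪q⁻ ⁅ v ⁆ S x∈
  ... | inj₁ x∈⁅v⁆ = inj₁ (x∈⁅y⁆⇒x≡y v x∈⁅v⁆)
  ... | inj₂ x∈S   = inj₂ x∈S

  independent-with-v : Independent G (⁅ v ⁆ ∪ S)
  independent-with-v x y x∈ y∈ with member x∈ | member y∈
  ... | inj₁ refl | inj₁ refl = loopless v
  ... | inj₁ refl | inj₂ y∈S  = isolated y y∈S
  ... | inj₂ x∈S  | inj₁ refl = isolated x x∈S ∘ symmetric x v
  ... | inj₂ x∈S  | inj₂ y∈S  = independent x y x∈S y∈S

Avoids : ∀ {n k} → (Fin n → Fin k) → Subset n → Fin k → Set
Avoids label S c = ∀ a → a ∈ S → label a ≢ c

module CliqueLabelling {n k} (G : Graph n) (label : Fin n → Fin k)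
                       (clique : ∀ u v → label u ≡ label v → u ≢ v → G u v) where

  independent-injective : ∀ {S} → Independent G S →
                          ∀ {u v} → u ∈ S → v ∈ S → label u ≡ label v → u ≡ v
  independent-injective independent {u} {v} u∈S v∈S same with u ≟ᶠ v
  ... | yes u≡v = u≡v
  ... | no u≢v  = ⊥-elim (independent u v u∈S v∈S (clique u v same u≢v))

  -- Membership and labels are decidable, so a set that does not avoid
  -- the label c contains a vertex labelled c.
  representative : ∀ S c → ¬ Avoids label S c → ∃ λ a → a ∈ S × label a ≡ c
  representative S c not-avoided = decidable-stable (any? λ a → (a ∈? S) ×-dec (label a ≟ᶠ c))
    λ none → not-avoided λ a a∈S labelled → none (a , a∈S , labelled)

  maximal-size : ∀ S → MaximalIndependent G S → (∀ c → ¬ Avoids label S c) → ∣ S ∣ ≡ k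
  maximal-size S (independent , _) meets =
    ∣transversal∣ S label (independent-injective independent) (λ c → representative S c (meets c))

  well-covered : (∀ S → MaximalIndependent G S → ∀ c → ¬ Avoids label S c) → WellCovered G
  well-covered meets S T maxS maxT =
    trans (maximal-size S maxS (meets S maxS)) (sym (maximal-size T maxT (meets T maxT)))

-- The inverse of the numbering decode m of the vertices of P_m; it is
-- needed to read statements about subsets of Fin (2m + 5) on P_m itself.
module Coding (m : ℕ) where

  encode : PVertex m → Fin (m * 2 + 5)
  encode (xv i s) = combine i s ↑ˡ 5
  encode (yv k)   = (m * 2) ↑ʳ (k ↑ˡ 3)
  encode (zv l)   = (m * 2) ↑ʳ (2 ↑ʳ l)

  decode-encode : ∀ v → decode m (encode v) ≡ v
  decode-encode (xv i s)
    rewrite splitAt-↑ˡ (m * 2) (combine i s) 5 | cong swap (remQuot-combine i s) = refl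
  decode-encode (yv k) rewrite splitAt-↑ʳ (m * 2) 5 (k ↑ˡ 3) | splitAt-↑ˡ 2 k 3 = refl
  decode-encode (zv l) rewrite splitAt-↑ʳ (m * 2) 5 (2 ↑ʳ l) | splitAt-↑ʳ 2 3 l = refl

  encode-decode : ∀ a → encode (decode m a) ≡ a
  encode-decode a with splitAt (m * 2) a in split-a
  ... | inj₁ b with quotRem {m} 2 b in quotRem-b
  ...   | (s , i) = trans (cong (_↑ˡ 5) combine-is) (splitAt⁻¹-↑ˡ split-a)
    where
    combine-is : combine i s ≡ b
    combine-is = trans (cong (λ (s , i) → combine i s) (sym quotRem-b)) (combine-remQuot {m} 2 b)
  encode-decode a | inj₂ c with splitAt 2 {3} c in split-c
  ...   | inj₁ k = trans (cong ((m * 2) ↑ʳ_) (splitAt⁻¹-↑ˡ split-c)) (splitAt⁻¹-↑ʳ split-a)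
  ...   | inj₂ l = trans (cong ((m * 2) ↑ʳ_) (splitAt⁻¹-↑ʳ split-c)) (splitAt⁻¹-↑ʳ split-a)

  decode-injective : ∀ {a b} → decode m a ≡ decode m b → a ≡ b
  decode-injective {a} {b} e = trans (sym (encode-decode a)) (trans (cong encode e) (encode-decode b))

PAdj-loopless : ∀ {m} (v : PVertex m) → ¬ PAdj v v
PAdj-loopless (xv i s) i≢i = i≢i refl
PAdj-loopless (yv k)   ()
PAdj-loopless (zv l)   l≢l = l≢l refl

PAdj-symmetric : ∀ {m} (v w : PVertex m) → PAdj v w → PAdj w v
PAdj-symmetric (xv i s) (xv j t) i≢j = i≢j ∘ sym
PAdj-symmetric (xv i s) (yv k)   s≡k = s≡k
PAdj-symmetric (yv k)   (xv i s) s≡k = s≡k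
PAdj-symmetric (zv l)   (zv l')  l≢l' = l≢l' ∘ sym
PAdj-symmetric (yv zero)       (zv zero)       tt = tt
PAdj-symmetric (yv (suc zero)) (zv (suc zero)) tt = tt
PAdj-symmetric (zv zero)       (yv zero)       tt = tt
PAdj-symmetric (zv (suc zero)) (yv (suc zero)) tt = tt
PAdj-symmetric (yv zero)       (zv (suc _))       ()
PAdj-symmetric (yv (suc zero)) (zv zero)          ()
PAdj-symmetric (yv (suc zero)) (zv (suc (suc _))) ()
PAdj-symmetric (zv zero)          (yv (suc zero)) ()
PAdj-symmetric (zv (suc zero))    (yv zero)       ()
PAdj-symmetric (zv (suc (suc _))) (yv _)          ()

side : Fin 2 → Fin 3
side zero       = zero
side (suc zero) = suc zero

triangle : Fin 3
triangle = suc (suc zero)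

part : ∀ {m} → PVertex m → Fin 3
part (xv _ s) = side s
part (yv s)   = side s
part (zv _)   = triangle

side-injective : ∀ {s t} → side s ≡ side t → s ≡ t
side-injective {zero}     {zero}     _ = refl
side-injective {suc zero} {suc zero} _ = refl
side-injective {zero}     {suc zero} ()
side-injective {suc zero} {zero}     ()

side≢triangle : ∀ s → side s ≢ triangle
side≢triangle zero       ()
side≢triangle (suc zero) ()

part-clique : ∀ {m} (v w : PVertex m) → part v ≡ part w → v ≢ w → PAdj v w
part-clique (xv i s) (xv j t) same v≢w i≡j = v≢w (cong₂ xv i≡j (side-injective same))
part-clique (xv i s) (yv t)   same _   = side-injective same
part-clique (yv s)   (xv i t) same _   = sym (side-injective same)
part-clique (yv s)   (yv t)   same v≢w = v≢w (cong yv (side-injective same))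
part-clique (zv l)   (zv l')  _    v≢w l≡l' = v≢w (cong zv l≡l')
part-clique (xv _ s) (zv _)   same _   = side≢triangle s same
part-clique (yv s)   (zv _)   same _   = ⊥-elim (side≢triangle s same)
part-clique (zv _)   (xv _ s) same _   = side≢triangle s (sym same)
part-clique (zv _)   (yv s)   same _   = ⊥-elim (side≢triangle s (sym same))

label : ∀ m → Fin (m * 2 + 5) → Fin 3
label m a = part (decode m a)

P-loopless : ∀ m u → ¬ P m u u
P-loopless m u = PAdj-loopless (decode m u)

P-symmetric : ∀ m u v → P m u v → P m v u
P-symmetric m u v = PAdj-symmetric (decode m u) (decode m v)

P-clique : ∀ m u v → label m u ≡ label m v → u ≢ v → P m u v
P-clique m u v same u≢v = part-clique (decode m u) (decode m v) same (u≢v ∘ decode-injective)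
  where open Coding m

-- A maximal independent set S of P_m meets all three parts, provided P_m has
-- some pair of x's, here indexed by i₀.
module Meeting (m : ℕ) (i₀ : Fin m) {S} (maxS : MaximalIndependent (P m) S) where
  open Coding m

  In : PVertex m → Set
  In v = encode v ∈ S

  independent : ∀ {v w} → In v → In w → ¬ PAdj v w
  independent {v} {w} v∈S w∈S vw = proj₁ maxS (encode v) (encode w) v∈S w∈S
    (subst₂ PAdj (sym (decode-encode v)) (sym (decode-encode w)) vw)

  dominated : ∀ {v} → ¬ In v → ¬ (∀ w → In w → ¬ PAdj v w)
  dominated {v} v∉S isolated =
    outside-dominated (P m) (P-loopless m) (P-symmetric m) maxS v∉S λ u u∈S vu →
      isolated (decode m u) (subst (_∈ S) (sym (encode-decode u)) u∈S)
               (subst (λ x → PAdj x (decode m u)) (decode-encode v) vu)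

  AvoidsPart : Fin 3 → Set
  AvoidsPart c = ∀ v → In v → part v ≢ c

  -- If S avoided side s, the vertex x_{i₀,s} ∉ S would have a neighbour
  -- x_{j,t} ∈ S; then x_{j,s} ∉ S would have no neighbour in S: y_s lies on
  -- side s, and every x_{k,·} adjacent to x_{j,s} is adjacent to x_{j,t}.
  meets-side : ∀ s → ¬ AvoidsPart (side s)
  meets-side s avoids = dominated (λ x∈S → avoids (xv i₀ s) x∈S refl) no-neighbour
    where
    no-neighbour : ∀ w → In w → ¬ PAdj (xv i₀ s) w
    no-neighbour (yv t)   y∈S refl = avoids (yv s) y∈S refl
    no-neighbour (zv _)   _   ()
    no-neighbour (xv j t) x∈S _    = dominated (λ x'∈S → avoids (xv j s) x'∈S refl) partner-isolated
      where
      partner-isolated : ∀ w → In w → ¬ PAdj (xv j s) w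
      partner-isolated (xv k u) x'∈S j≢k = independent {xv j t} {xv k u} x∈S x'∈S j≢k
      partner-isolated (yv t')  y∈S  refl = avoids (yv s) y∈S refl
      partner-isolated (zv _)   _    ()

  -- If S avoided the triangle, z₃ ∉ S would have no neighbour in S, since
  -- all its neighbours lie in the triangle.
  meets-triangle : ¬ AvoidsPart triangle
  meets-triangle avoids = dominated (λ z∈S → avoids z₃ z∈S refl) no-neighbour
    where
    z₃ : PVertex m
    z₃ = zv (suc (suc zero))

    no-neighbour : ∀ w → In w → ¬ PAdj z₃ w
    no-neighbour (zv l)   z∈S _ = avoids (zv l) z∈S refl
    no-neighbour (xv _ _) _   ()
    no-neighbour (yv _)   _   ()

  meets-part : ∀ c → ¬ AvoidsPart c
  meets-part zero             = meets-side zero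
  meets-part (suc zero)       = meets-side (suc zero)
  meets-part (suc (suc zero)) = meets-triangle

  meets : ∀ c → ¬ Avoids (label m) S c
  meets c avoids = meets-part c λ v v∈S same →
    avoids (encode v) v∈S (trans (cong part (decode-encode v)) same)

-- P_m is well-covered: its three parts are cliques met by every maximal
-- independent set.
theorem6p6 : (m : ℕ) → 2 ≤ m → WellCovered (P m)
theorem6p6 zero    ()
theorem6p6 (suc m) _ = CliqueLabelling.well-covered (P (suc m)) (label (suc m)) (P-clique (suc m))
  (λ S maxS → Meeting.meets (suc m) zero maxS)
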